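{- Let $\overrightarrow{AB},\overrightarrow{CD}$ be distinct prime segments in $\mathcal{G}_{m,n}$ such that $f_{\overrightarrow{AB}}(C)=1$, $f_{\overrightarrow{AB}}(D)=0$, and $f_{\overrightarrow{CD}}(A)=1$. Then $f_{\overrightarrow{CD}}(B)=1$, the points $B,C,D$ are not collinear, and $A$ lies in the triangle $BCD$.
   Context: $\mathcal{G}_{m,n}=\{0,\dots,m-1\}\times\{0,\dots,n-1\}$. Two integer points are adjacent if the segment joining them contains no other integer point; such a segment is called prime. For distinct points $A,B,C$ the oriented triangle $\overrightarrow{ABC}$ is counterclockwise if the determinant with rows $(a_1,a_2,1),(b_1,b_2,1),(c_1,c_2,1)$ is positive. For adjacent $A,B\in\mathcal{G}_{m,n}$, $f_{\overrightarrow{AB}}:\mathcal{G}_{m,n}\to\{0,1\}$ has $f(A)=1$, $f(B)=0$; for $X$ on the line $\ell(AB)$, $f(X)=1$ iff $d(A,X)<d(B,X)$; for $X\notin\ell(AB)$, $f(X)=1$ iff $\overrightarrow{ABX}$ is counterclockwise. -}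

module Defs where

open import Data.Bool using (Bool; true; false; if_then_else_)
open import Data.Nat using (ℕ)
open import Data.Integer using (ℤ; +_; _+_; _-_; _*_; _≤_; _<_; _<?_)
open import Data.Integer.Properties using () renaming (_≟_ to _≟ℤ_)
open import Data.Product using (_×_; _,_; proj₁; proj₂; ∃-syntax)
open import Data.Sum using (_⊎_)
open import Relation.Nullary using (¬_)
open import Relation.Nullary.Decidable using (⌊_⌋)
open import Relation.Binary.PropositionalEquality using (_≡_)

Point : Set
Point = ℤ × ℤ

x : Point → ℤ
x = proj₁

y : Point → ℤ
y = proj₂

InGrid : ℕ → ℕ → Point → Set
InGrid m n P = (+ 0 ≤ x P × x P < + m) × (+ 0 ≤ y P × y P < + n)

-- determinant with rows (a1,a2,1),(b1,b2,1),(c1,c2,1) (cofactor expansion)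
det : Point → Point → Point → ℤ
det A B C = (x A * (y B - y C) - y A * (x B - x C)) + (x B * y C - y B * x C)

CCW : Point → Point → Point → Set
CCW A B C = + 0 < det A B C

Collinear : Point → Point → Point → Set
Collinear A B C = det A B C ≡ + 0

-- squared Euclidean distance (comparison of distances = comparison of squares)
dist² : Point → Point → ℤ
dist² P Q = (x P - x Q) * (x P - x Q) + (y P - y Q) * (y P - y Q)

OnSegment : Point → Point → Point → Set
OnSegment A B X =
  Collinear A B X × ((x X - x A) * (x X - x B) + (y X - y A) * (y X - y B) ≤ + 0)

Adjacent : Point → Point → Set
Adjacent A B = ¬ (A ≡ B) × (∀ X → OnSegment A B X → (X ≡ A) ⊎ (X ≡ B))

f : Point → Point → Point → Bool
f A B X =
  if ⌊ det A B X ≟ℤ + 0 ⌋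
  then ⌊ dist² A X <? dist² B X ⌋
  else ⌊ + 0 <? det A B X ⌋

-- P lies in the (closed) triangle with vertices B, C, D, i.e. in their convex hull;
-- barycentric coordinates are rational, written with a common positive denominator s
InTriangle : Point → Point → Point → Point → Set
InTriangle P B C D =
  ∃[ l₁ ] ∃[ l₂ ] ∃[ l₃ ] ∃[ s ]
    (+ 0 ≤ l₁ × + 0 ≤ l₂ × + 0 ≤ l₃ × + 0 < s × l₁ + l₂ + l₃ ≡ s ×
     s * x P ≡ l₁ * x B + l₂ * x C + l₃ * x D ×
     s * y P ≡ l₁ * y B + l₂ * y C + l₃ * y D)

-- By Cramer's rule det B C D = det C D A − det A B D + det A B C, and the hypotheses make each
-- summand nonnegative; so once det B C D ≠ 0 the summands are barycentric coordinates of A in BCD,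
-- and det C D B = det B C D > 0 gives f_{CD}(B) = 1.  If det B C D vanished, so would every summand,
-- and A, B, C, D would lie on one line.  Parametrise it by t X = ⟨B − A, X − A⟩, so t A = 0 and
-- t B = |AB|².  As AB is prime, no lattice point of the line has 0 < t < |AB|²; since C is nearer to A
-- than to B and D is not, t C ≤ 0 and t D ≥ |AB|².  Then A and B both lie on the prime segment CD,
-- which forces (A , B) = (C , D).
module Submission where

open import Defs
open import Data.Nat using (ℕ; z≤n; s≤s)
open import Data.Bool using (true; false)
open import Data.Product using (_×_; _,_)
open import Data.Sum using (_⊎_; inj₁; inj₂)
open import Data.Empty using (⊥; ⊥-elim)
open import Data.Integer
  using (ℤ; +_; +[1+_]; -[1+_]; _+_; _-_; _*_; -_; _≤_; _<_; _<?_; +≤+; +<+; nonNegative; positive)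
open import Data.Integer.Properties
  using (≤-reflexive; ≤-trans; ≤-antisym; <⇒≤; <⇒≱; <-irrefl; ≤∧≢⇒<; ≮⇒≥; ≰⇒>;
         +-identityʳ; +-mono-≤; +-mono-<-≤; +-mono-≤-<; +-monoʳ-≤; +-monoʳ-<; +-monoˡ-≤; +-monoˡ-<;
         i≤i+j; i≤j+i; neg-mono-≤; neg-injective; *-zeroʳ; *-monoʳ-≤-nonNeg; *-cancelˡ-≤-pos;
         i≤j⇒i-j≤0; i≤j⇒0≤j-i; i-j≡0⇒i≡j; pos-*; +-0-abelianGroup; module ≤-Reasoning)
  renaming (_≟_ to _≟ℤ_)
open import Algebra.Properties.AbelianGroup +-0-abelianGroup using () renaming (\\-leftDividesʳ to -i+[i+j]≡j)
open import Data.Integer.Tactic.RingSolver using (solve-∀)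
open import Relation.Nullary using (¬_; yes; no)
open import Relation.Binary.PropositionalEquality
  using (_≡_; _≢_; refl; sym; trans; cong; cong₂; subst; subst₂; ≢-sym)

private
  variable
    A B C D X : Point
    i j k : ℤ

+-cancelˡ-< : ∀ i → i + j < i + k → j < k
+-cancelˡ-< {j} {k} i h = subst₂ _<_ (-i+[i+j]≡j i j) (-i+[i+j]≡j i k) (+-monoʳ-< (- i) h)

+-cancelˡ-≤ : ∀ i → i + j ≤ i + k → j ≤ k
+-cancelˡ-≤ {j} {k} i h = subst₂ _≤_ (-i+[i+j]≡j i j) (-i+[i+j]≡j i k) (+-monoʳ-≤ (- i) h)

square-nonneg : ∀ i → + 0 ≤ i * i
square-nonneg (+ n)    = subst (+ 0 ≤_) (pos-* n n) (+≤+ z≤n)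
square-nonneg -[1+ n ] = +≤+ z≤n

square-pos : i ≢ + 0 → + 0 < i * i
square-pos {+ 0}      i≢0 = ⊥-elim (i≢0 refl)
square-pos {+[1+ n ]} _   = +<+ (s≤s z≤n)
square-pos { -[1+ n ]} _  = +<+ (s≤s z≤n)

nonneg-sum-zero : + 0 ≤ i → + 0 ≤ j → + 0 ≤ k → i + j + k ≡ + 0 →
                  i ≡ + 0 × j ≡ + 0 × k ≡ + 0
nonneg-sum-zero {i} {j} {k} 0≤i 0≤j 0≤k sum≡0 =
    ≤-antisym (≤-trans (i≤i+j i j {{nonNegative 0≤j}}) i+j≤0) 0≤i
  , ≤-antisym (≤-trans (i≤j+i j i {{nonNegative 0≤i}}) i+j≤0) 0≤j
  , ≤-antisym (≤-trans (i≤j+i k (i + j) {{nonNegative (+-mono-≤ 0≤i 0≤j)}}) (≤-reflexive sum≡0)) 0≤k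
  where
  i+j≤0 : i + j ≤ + 0
  i+j≤0 = ≤-trans (i≤i+j (i + j) k {{nonNegative 0≤k}}) (≤-reflexive sum≡0)

dot : Point → Point → Point → ℤ
dot A B X = (x B - x A) * (x X - x A) + (y B - y A) * (y X - y A)

dot-base : ∀ A B → dot A B A ≡ + 0
dot-base (a₁ , a₂) (b₁ , b₂) = identity a₁ a₂ b₁ b₂
  where
  identity : ∀ a₁ a₂ b₁ b₂ → (b₁ - a₁) * (a₁ - a₁) + (b₂ - a₂) * (a₂ - a₂) ≡ + 0
  identity = solve-∀

det-repeatˡ : ∀ A B → det A B A ≡ + 0
det-repeatˡ (a₁ , a₂) (b₁ , b₂) = identity a₁ a₂ b₁ b₂
  where
  identity : ∀ a₁ a₂ b₁ b₂ → (a₁ * (b₂ - a₂) - a₂ * (b₁ - a₁)) + (b₁ * a₂ - b₂ * a₁) ≡ + 0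
  identity = solve-∀

det-repeatʳ : ∀ A B → det A B B ≡ + 0
det-repeatʳ (a₁ , a₂) (b₁ , b₂) = identity a₁ a₂ b₁ b₂
  where
  identity : ∀ a₁ a₂ b₁ b₂ → (a₁ * (b₂ - b₂) - a₂ * (b₁ - b₁)) + (b₁ * b₂ - b₂ * b₁) ≡ + 0
  identity = solve-∀

det-rotate : ∀ A B C → det A B C ≡ det B C A
det-rotate (a₁ , a₂) (b₁ , b₂) (c₁ , c₂) = identity a₁ a₂ b₁ b₂ c₁ c₂
  where
  identity : ∀ a₁ a₂ b₁ b₂ c₁ c₂ →
    (a₁ * (b₂ - c₂) - a₂ * (b₁ - c₁)) + (b₁ * c₂ - b₂ * c₁) ≡
    (b₁ * (c₂ - a₂) - b₂ * (c₁ - a₁)) + (c₁ * a₂ - c₂ * a₁)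
  identity = solve-∀

det-split : ∀ A B C D → det C D A + - det A B D + det A B C ≡ det B C D
det-split (a₁ , a₂) (b₁ , b₂) (c₁ , c₂) (d₁ , d₂) = identity a₁ a₂ b₁ b₂ c₁ c₂ d₁ d₂
  where
  identity : ∀ a₁ a₂ b₁ b₂ c₁ c₂ d₁ d₂ →
    ((c₁ * (d₂ - a₂) - c₂ * (d₁ - a₁)) + (d₁ * a₂ - d₂ * a₁))
      + - ((a₁ * (b₂ - d₂) - a₂ * (b₁ - d₁)) + (b₁ * d₂ - b₂ * d₁))
      + ((a₁ * (b₂ - c₂) - a₂ * (b₁ - c₁)) + (b₁ * c₂ - b₂ * c₁)) ≡
    (b₁ * (c₂ - d₂) - b₂ * (c₁ - d₁)) + (c₁ * d₂ - c₂ * d₁)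
  identity = solve-∀

det-barycentric : ∀ A B C D →
  (det B C D * x A ≡ det C D A * x B + - det A B D * x C + det A B C * x D) ×
  (det B C D * y A ≡ det C D A * y B + - det A B D * y C + det A B C * y D)
det-barycentric (a₁ , a₂) (b₁ , b₂) (c₁ , c₂) (d₁ , d₂) =
  identityˣ a₁ a₂ b₁ b₂ c₁ c₂ d₁ d₂ , identityʸ a₁ a₂ b₁ b₂ c₁ c₂ d₁ d₂
  where
  identityˣ : ∀ a₁ a₂ b₁ b₂ c₁ c₂ d₁ d₂ →
    ((b₁ * (c₂ - d₂) - b₂ * (c₁ - d₁)) + (c₁ * d₂ - c₂ * d₁)) * a₁ ≡
    ((c₁ * (d₂ - a₂) - c₂ * (d₁ - a₁)) + (d₁ * a₂ - d₂ * a₁)) * b₁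
      + - ((a₁ * (b₂ - d₂) - a₂ * (b₁ - d₁)) + (b₁ * d₂ - b₂ * d₁)) * c₁
      + ((a₁ * (b₂ - c₂) - a₂ * (b₁ - c₁)) + (b₁ * c₂ - b₂ * c₁)) * d₁
  identityˣ = solve-∀
  identityʸ : ∀ a₁ a₂ b₁ b₂ c₁ c₂ d₁ d₂ →
    ((b₁ * (c₂ - d₂) - b₂ * (c₁ - d₁)) + (c₁ * d₂ - c₂ * d₁)) * a₂ ≡
    ((c₁ * (d₂ - a₂) - c₂ * (d₁ - a₁)) + (d₁ * a₂ - d₂ * a₁)) * b₂
      + - ((a₁ * (b₂ - d₂) - a₂ * (b₁ - d₁)) + (b₁ * d₂ - b₂ * d₁)) * c₂
      + ((a₁ * (b₂ - c₂) - a₂ * (b₁ - c₁)) + (b₁ * c₂ - b₂ * c₁)) * d₂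
  identityʸ = solve-∀

cosine-law : ∀ A B X → dist² B X + (dot A B X + dot A B X) ≡ dist² A X + dist² B A
cosine-law (a₁ , a₂) (b₁ , b₂) (u₁ , u₂) = identity a₁ a₂ b₁ b₂ u₁ u₂
  where
  identity : ∀ a₁ a₂ b₁ b₂ u₁ u₂ →
    (b₁ - u₁) * (b₁ - u₁) + (b₂ - u₂) * (b₂ - u₂)
      + (((b₁ - a₁) * (u₁ - a₁) + (b₂ - a₂) * (u₂ - a₂))
         + ((b₁ - a₁) * (u₁ - a₁) + (b₂ - a₂) * (u₂ - a₂))) ≡
    (a₁ - u₁) * (a₁ - u₁) + (a₂ - u₂) * (a₂ - u₂) + ((b₁ - a₁) * (b₁ - a₁) + (b₂ - a₂) * (b₂ - a₂))
  identity = solve-∀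

-- Lagrange's identity |u|² ⟨v , w⟩ = ⟨u , v⟩ ⟨u , w⟩ + (u × v) (u × w) for u = B − A, v = P − X, w = Q − X.
lagrange : ∀ A B P Q X →
  dist² B A * ((x X - x P) * (x X - x Q) + (y X - y P) * (y X - y Q)) ≡
  (dot A B P - dot A B X) * (dot A B Q - dot A B X) + (det A B P - det A B X) * (det A B Q - det A B X)
lagrange (a₁ , a₂) (b₁ , b₂) (p₁ , p₂) (q₁ , q₂) (u₁ , u₂) = identity a₁ a₂ b₁ b₂ p₁ p₂ q₁ q₂ u₁ u₂
  where
  identity : ∀ a₁ a₂ b₁ b₂ p₁ p₂ q₁ q₂ u₁ u₂ →
    ((b₁ - a₁) * (b₁ - a₁) + (b₂ - a₂) * (b₂ - a₂)) * ((u₁ - p₁) * (u₁ - q₁) + (u₂ - p₂) * (u₂ - q₂)) ≡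
    (((b₁ - a₁) * (p₁ - a₁) + (b₂ - a₂) * (p₂ - a₂)) - ((b₁ - a₁) * (u₁ - a₁) + (b₂ - a₂) * (u₂ - a₂)))
      * (((b₁ - a₁) * (q₁ - a₁) + (b₂ - a₂) * (q₂ - a₂)) - ((b₁ - a₁) * (u₁ - a₁) + (b₂ - a₂) * (u₂ - a₂)))
    + (((a₁ * (b₂ - p₂) - a₂ * (b₁ - p₁)) + (b₁ * p₂ - b₂ * p₁)) - ((a₁ * (b₂ - u₂) - a₂ * (b₁ - u₁)) + (b₁ * u₂ - b₂ * u₁)))
      * (((a₁ * (b₂ - q₂) - a₂ * (b₁ - q₁)) + (b₁ * q₂ - b₂ * q₁)) - ((a₁ * (b₂ - u₂) - a₂ * (b₁ - u₁)) + (b₁ * u₂ - b₂ * u₁)))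
  identity = solve-∀

dist²-pos : A ≢ B → + 0 < dist² A B
dist²-pos {a₁ , a₂} {b₁ , b₂} A≢B with a₁ - b₁ ≟ℤ + 0 | a₂ - b₂ ≟ℤ + 0
... | no  Δ₁≢0 | _        = +-mono-<-≤ (square-pos Δ₁≢0) (square-nonneg (a₂ - b₂))
... | yes _    | no Δ₂≢0  = +-mono-≤-< (square-nonneg (a₁ - b₁)) (square-pos Δ₂≢0)
... | yes Δ₁≡0 | yes Δ₂≡0 = ⊥-elim (A≢B (cong₂ _,_ (i-j≡0⇒i≡j a₁ b₁ Δ₁≡0) (i-j≡0⇒i≡j a₂ b₂ Δ₂≡0)))

dot-between⇒OnSegment : ∀ {A B P Q X} → A ≢ B → Collinear A B P → Collinear A B X → Collinear P Q X →
                         dot A B P ≤ dot A B X → dot A B X ≤ dot A B Q → OnSegment P Q X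
dot-between⇒OnSegment {A} {B} {P} {Q} {X} A≢B abP abX pqX P≤X X≤Q =
  pqX , *-cancelˡ-≤-pos _ (+ 0) (dist² B A) {{positive (dist²-pos (≢-sym A≢B))}} N*q≤N*0
  where
  open ≤-Reasoning
  N*q≤N*0 : dist² B A * ((x X - x P) * (x X - x Q) + (y X - y P) * (y X - y Q)) ≤ dist² B A * + 0
  N*q≤N*0 = begin
    dist² B A * ((x X - x P) * (x X - x Q) + (y X - y P) * (y X - y Q))
      ≡⟨ lagrange A B P Q X ⟩
    (dot A B P - dot A B X) * (dot A B Q - dot A B X) + (det A B P - det A B X) * (det A B Q - det A B X)
      ≡⟨ cong₂ (λ u v → (dot A B P - dot A B X) * (dot A B Q - dot A B X) + (u - v) * (det A B Q - v)) abP abX ⟩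
    (dot A B P - dot A B X) * (dot A B Q - dot A B X) + + 0 * (det A B Q - + 0)
      ≡⟨ +-identityʳ _ ⟩
    (dot A B P - dot A B X) * (dot A B Q - dot A B X)
      ≤⟨ *-monoʳ-≤-nonNeg _ {{nonNegative (i≤j⇒0≤j-i X≤Q)}} (i≤j⇒i-j≤0 P≤X) ⟩
    + 0
      ≡⟨ *-zeroʳ (dist² B A) ⟨
    dist² B A * + 0 ∎

adjacent⇒¬interior : Adjacent A B → Collinear A B X → + 0 < dot A B X → dot A B X < dist² B A → ⊥
adjacent⇒¬interior {A} {B} {X} (A≢B , prime) abX 0<t t<N = endpoint (prime X onAB)
  where
  onAB : OnSegment A B X
  onAB = dot-between⇒OnSegment A≢B (det-repeatˡ A B) abX abX
           (subst (_≤ dot A B X) (sym (dot-base A B)) (<⇒≤ 0<t)) (<⇒≤ t<N)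
  endpoint : (X ≡ A) ⊎ (X ≡ B) → ⊥
  endpoint (inj₁ X≡A) = <-irrefl (sym (trans (cong (dot A B) X≡A) (dot-base A B))) 0<t
  endpoint (inj₂ X≡B) = <-irrefl (cong (dot A B) X≡B) t<N

nearer⇒dot≤0 : Adjacent A B → Collinear A B X → dist² A X < dist² B X → dot A B X ≤ + 0
nearer⇒dot≤0 {A} {B} {X} adj abX nearer = ≮⇒≥ (λ 0<t → adjacent⇒¬interior adj abX 0<t (t<N 0<t))
  where
  open ≤-Reasoning
  2t<N : dot A B X + dot A B X < dist² B A
  2t<N = +-cancelˡ-< (dist² A X) (begin-strict
    dist² A X + (dot A B X + dot A B X) <⟨ +-monoˡ-< (dot A B X + dot A B X) nearer ⟩
    dist² B X + (dot A B X + dot A B X) ≡⟨ cosine-law A B X ⟩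
    dist² A X + dist² B A               ∎)
  t<N : + 0 < dot A B X → dot A B X < dist² B A
  t<N 0<t = begin-strict
    dot A B X             ≡⟨ +-identityʳ (dot A B X) ⟨
    dot A B X + + 0       <⟨ +-monoʳ-< (dot A B X) 0<t ⟩
    dot A B X + dot A B X <⟨ 2t<N ⟩
    dist² B A             ∎

not-nearer⇒dist²≤dot : Adjacent A B → Collinear A B X → dist² B X ≤ dist² A X → dist² B A ≤ dot A B X
not-nearer⇒dist²≤dot {A} {B} {X} adj@(A≢B , _) abX not-nearer = ≮⇒≥ (adjacent⇒¬interior adj abX 0<t)
  where
  open ≤-Reasoning
  N≤2t : dist² B A ≤ dot A B X + dot A B X
  N≤2t = +-cancelˡ-≤ (dist² A X) (begin
    dist² A X + dist² B A               ≡⟨ cosine-law A B X ⟨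
    dist² B X + (dot A B X + dot A B X) ≤⟨ +-monoˡ-≤ (dot A B X + dot A B X) not-nearer ⟩
    dist² A X + (dot A B X + dot A B X) ∎)
  0<t : + 0 < dot A B X
  0<t = ≰⇒> (λ t≤0 → <⇒≱ (dist²-pos (≢-sym A≢B)) (≤-trans N≤2t (+-mono-≤ t≤0 t≤0)))

collinear-configuration-impossible :
  Adjacent A B → Adjacent C D → (A , B) ≢ (C , D) →
  Collinear A B C → Collinear A B D → Collinear C D A → Collinear C D B →
  dist² A C < dist² B C → dist² B D ≤ dist² A D → ⊥
collinear-configuration-impossible {A} {B} {C} {D} adjAB@(A≢B , _) (_ , primeCD) AB≢CD
                                   abC abD cdA cdB nearerC not-nearerD =
  endpoints (primeCD A A∈CD) (primeCD B B∈CD)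
  where
  N>0 : + 0 < dist² B A
  N>0 = dist²-pos (≢-sym A≢B)
  tC≤0 : dot A B C ≤ + 0
  tC≤0 = nearer⇒dot≤0 adjAB abC nearerC
  N≤tD : dist² B A ≤ dot A B D
  N≤tD = not-nearer⇒dist²≤dot adjAB abD not-nearerD
  A∈CD : OnSegment C D A
  A∈CD = dot-between⇒OnSegment A≢B abC (det-repeatˡ A B) cdA
           (subst (dot A B C ≤_) (sym (dot-base A B)) tC≤0)
           (subst (_≤ dot A B D) (sym (dot-base A B)) (≤-trans (<⇒≤ N>0) N≤tD))
  B∈CD : OnSegment C D B
  B∈CD = dot-between⇒OnSegment A≢B abC (det-repeatʳ A B) cdB (≤-trans tC≤0 (<⇒≤ N>0)) N≤tD
  endpoints : (A ≡ C) ⊎ (A ≡ D) → (B ≡ C) ⊎ (B ≡ D) → ⊥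
  endpoints _ (inj₁ B≡C) = <⇒≱ N>0 (subst (λ Y → dot A B Y ≤ + 0) (sym B≡C) tC≤0)
  endpoints (inj₂ A≡D) _ = <⇒≱ N>0 (subst (dist² B A ≤_) (trans (cong (dot A B) (sym A≡D)) (dot-base A B)) N≤tD)
  endpoints (inj₁ A≡C) (inj₂ B≡D) = AB≢CD (cong₂ _,_ A≡C B≡D)

f≡true⇒det≥0 : ∀ A B X → f A B X ≡ true → + 0 ≤ det A B X
f≡true⇒det≥0 A B X fX with det A B X ≟ℤ + 0 | + 0 <? det A B X
... | yes det≡0 | _     = ≤-reflexive (sym det≡0)
... | no _      | yes p = <⇒≤ p

f≡false⇒det≤0 : ∀ A B X → f A B X ≡ false → det A B X ≤ + 0
f≡false⇒det≤0 A B X fX with det A B X ≟ℤ + 0 | + 0 <? det A B X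
... | yes det≡0 | _     = ≤-reflexive det≡0
... | no _      | no ¬p = ≮⇒≥ ¬p

f≡true⇒nearer : ∀ A B X → f A B X ≡ true → Collinear A B X → dist² A X < dist² B X
f≡true⇒nearer A B X fX abX with det A B X ≟ℤ + 0 | dist² A X <? dist² B X
... | yes _ | yes p = p
... | no ¬abX | _   = ⊥-elim (¬abX abX)

f≡false⇒not-nearer : ∀ A B X → f A B X ≡ false → Collinear A B X → dist² B X ≤ dist² A X
f≡false⇒not-nearer A B X fX abX with det A B X ≟ℤ + 0 | dist² A X <? dist² B X
... | yes _ | no ¬p  = ≮⇒≥ ¬p
... | no ¬abX | _    = ⊥-elim (¬abX abX)

det>0⇒f≡true : ∀ A B X → + 0 < det A B X → f A B X ≡ true
det>0⇒f≡true A B X 0<det with det A B X ≟ℤ + 0 | + 0 <? det A B X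
... | yes det≡0 | _    = ⊥-elim (<-irrefl (sym det≡0) 0<det)
... | no _      | yes _ = refl
... | no _      | no ¬p = ⊥-elim (¬p 0<det)

claim9 : (m n : ℕ) (A B C D : Point) →
    InGrid m n A → InGrid m n B → InGrid m n C → InGrid m n D →
    Adjacent A B → Adjacent C D →
    ¬ ((A , B) ≡ (C , D)) →
    f A B C ≡ true → f A B D ≡ false → f C D A ≡ true →
    (f C D B ≡ true) × ¬ Collinear B C D × InTriangle A B C D
claim9 _ _ A B C D _ _ _ _ adjAB adjCD AB≢CD fC fD fA =
    det>0⇒f≡true C D B (subst (+ 0 <_) (det-rotate B C D) s>0)
  , (λ s≡0 → <-irrefl (sym s≡0) s>0)
  , (det C D A , - det A B D , det A B C , det B C D ,
     l₁≥0 , l₂≥0 , l₃≥0 , s>0 , det-split A B C D , det-barycentric A B C D)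
  where
  l₁≥0 : + 0 ≤ det C D A
  l₁≥0 = f≡true⇒det≥0 C D A fA
  l₂≥0 : + 0 ≤ - det A B D
  l₂≥0 = neg-mono-≤ (f≡false⇒det≤0 A B D fD)
  l₃≥0 : + 0 ≤ det A B C
  l₃≥0 = f≡true⇒det≥0 A B C fC
  all-collinear : det B C D ≡ + 0 → det C D A ≡ + 0 × - det A B D ≡ + 0 × det A B C ≡ + 0 → ⊥
  all-collinear s≡0 (cdA , -abD≡0 , abC) =
    collinear-configuration-impossible adjAB adjCD AB≢CD abC abD cdA
      (trans (sym (det-rotate B C D)) s≡0) (f≡true⇒nearer A B C fC abC) (f≡false⇒not-nearer A B D fD abD)
    where
    abD : det A B D ≡ + 0
    abD = neg-injective {j = + 0} -abD≡0
  s>0 : + 0 < det B C D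
  s>0 = ≤∧≢⇒< (subst (+ 0 ≤_) (det-split A B C D) (+-mono-≤ (+-mono-≤ l₁≥0 l₂≥0) l₃≥0))
          (λ 0≡s → all-collinear (sym 0≡s)
            (nonneg-sum-zero l₁≥0 l₂≥0 l₃≥0 (trans (det-split A B C D) (sym 0≡s))))
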